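{- Let $n$ be a positive integer. Knowlton-Graham partitions of $\{1,\ldots,n\}$ exist if and only if, for some positive integer $m$, there is an $m\times m$ matrix of 0s and 1s having row sums $(r_1,\ldots,r_m)$ and column sums $(c_1,\ldots,c_m)$ such that $r_j$ and $c_j$ are multiples of $j$ for each $1\le j\le m$, and $r_1+\cdots+r_m=c_1+\cdots+c_m=n$.
   Context: Knowlton-Graham partitions of $\{1,\ldots,n\}$ are two partitions $A_1,\ldots,A_p$ and $B_1,\ldots,B_q$ of $\{1,\ldots,n\}$ into disjoint nonempty sets such that, for every pair of positive integers $j,k$, at most one element of $\{1,\ldots,n\}$ lies both in some $A$-set of cardinality $j$ and in some $B$-set of cardinality $k$. -}

module Defs where

open import Data.Nat using (ℕ; zero; suc; _+_)
open import Data.Nat.Divisibility using (_∣_)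
open import Data.Fin using (Fin; zero; suc; toℕ; _≟_)
open import Data.Bool using (Bool; true; false; if_then_else_)
open import Data.Product using (Σ; ∃; _×_)
open import Relation.Nullary.Decidable using (⌊_⌋)
open import Relation.Binary.PropositionalEquality using (_≡_)

sumFin : ∀ {n} → (Fin n → ℕ) → ℕ
sumFin {zero}  f = 0
sumFin {suc n} f = f zero + sumFin (λ i → f (suc i))

-- A partition of {1,…,n} (modelled as Fin n) into disjoint nonempty sets is
-- given by a block-labelling  lab : Fin n → Fin n ; the blocks are the
-- nonempty fibres of lab (every partition arises this way, at most n blocks).
Partition : ℕ → Set
Partition n = Fin n → Fin n

blockSize : ∀ {n} → Partition n → Fin n → ℕ
blockSize lab x = sumFin (λ y → if ⌊ lab y ≟ lab x ⌋ then 1 else 0)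

KnowltonGraham : ∀ {n} → Partition n → Partition n → Set
KnowltonGraham {n} A B =
  ∀ (j k : ℕ) (x y : Fin n) →
    blockSize A x ≡ j → blockSize B x ≡ k →
    blockSize A y ≡ j → blockSize B y ≡ k → x ≡ y

KGExists : ℕ → Set
KGExists n = Σ (Partition n) λ A → Σ (Partition n) λ B → KnowltonGraham A B

Matrix01 : ℕ → Set
Matrix01 m = Fin m → Fin m → Bool

b2n : Bool → ℕ
b2n true  = 1
b2n false = 0

rowSum : ∀ {m} → Matrix01 m → Fin m → ℕ
rowSum M i = sumFin (λ j → b2n (M i j))

colSum : ∀ {m} → Matrix01 m → Fin m → ℕ
colSum M j = sumFin (λ i → b2n (M i j))

-- index i : Fin m stands for j = toℕ i + 1 ∈ {1,…,m}
GoodMatrix : ∀ m → ℕ → Matrix01 m → Set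
GoodMatrix m n M =
  (∀ (i : Fin m) → suc (toℕ i) ∣ rowSum M i) ×
  (∀ (i : Fin m) → suc (toℕ i) ∣ colSum M i) ×
  sumFin (rowSum M) ≡ n × sumFin (colSum M) ≡ n

-- A Knowlton–Graham pair (A, B) is exactly a pair of partitions for which x ↦ (|A-block of x|,
-- |B-block of x|) is injective. Given one, put a 1 at (j, k) iff some element has block sizes
-- (j, k): row j then counts the elements lying in A-blocks of size j, a multiple of j, and the
-- row sums add up to n; likewise for columns.
-- Conversely, enumerate the n one-entries of the matrix and let entry (j, k) ask for block sizes
-- j and k. Any size function f with j dividing #{x | f x = j} for every j is realised by a
-- partition: cut the elements with f x = j, in increasing order, into consecutive chunks of j,
-- i.e. put the r-th of them into chunk ⌊r / j⌋. Doing this for rows and for columns gives A and B,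
-- and injectivity of the enumeration gives the Knowlton–Graham property.
module Submission where

open import Defs
open import Data.Nat using (ℕ; zero; suc; _+_; _*_; _∸_; _/_; NonZero; _≤_; _<_; _≡ᵇ_; _<ᵇ_; z≤n; s≤s)
open import Data.Nat.Properties
  using (+-*-semiring; +-assoc; +-identityʳ; *-identityʳ; *-zeroʳ; *-assoc; *-comm;
         ≤-trans; ≤-reflexive; +-mono-≤; +-monoʳ-<; m≤n+m; m≤m+n; suc-injective; ≡ᵇ⇒≡; ≡⇒≡ᵇ; m+n∸m≡n)
  renaming (_≟_ to _≟ℕ_)
open import Data.Nat.DivMod using (m<n⇒m/n≡0; m/n≡1+[m∸n]/n; m<n*o⇒m/o<n)
open import Data.Nat.Divisibility using (_∣_; divides; _∣0; ∣m∣n⇒∣m+n; ∣-reflexive)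
open import Data.Fin using (Fin; zero; suc; toℕ; _↑ˡ_; _↑ʳ_; _≟_)
import Data.Fin.Properties as Fin
open import Data.Fin.Properties using (toℕ-↑ˡ; toℕ-↑ʳ; toℕ<n; toℕ-injective; 0≢1+n)
open import Data.Bool using (Bool; true; false; T; _∧_; if_then_else_)
open import Data.Bool.Properties using (T-≡; T-∧; ∧-comm)
open import Data.Product using (Σ; _×_; _,_; proj₁; proj₂; uncurry)
open import Data.Product.Properties using (≡-dec; ×-≡,≡→≡; ×-≡,≡←≡)
open import Data.Unit using (tt)
open import Data.Vec.Functional using (_++_)
open import Data.Vec.Functional.Properties using (lookup-++ˡ; lookup-++ʳ)
open import Function using (_∘_; flip; _⇔_; mk⇔; Equivalence)
open import Relation.Binary.Definitions using (DecidableEquality)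
open import Relation.Nullary using (Dec; yes; no; does; ¬_; contradiction)
open import Relation.Nullary.Decidable using (⌊_⌋; _×-dec_; does-⇔)
open import Relation.Binary.PropositionalEquality
open import Algebra.Properties.Semiring.Sum +-*-semiring
  using (sum; sum-syntax; sum-cong-≗; ∑-comm; *-distribˡ-sum; *-distribʳ-sum; sum-replicate-zero)

open ≡-Reasoning

sumFin≡sum : ∀ {n} (f : Fin n → ℕ) → sumFin f ≡ sum f
sumFin≡sum {zero}  f = refl
sumFin≡sum {suc n} f = cong (f zero +_) (sumFin≡sum (f ∘ suc))

sum-const : ∀ n c → ∑[ i < n ] c ≡ n * c
sum-const zero    c = refl
sum-const (suc n) c = cong (c +_) (sum-const n c)

sum-↑ : ∀ p {q} (g : Fin (p + q) → ℕ) →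
        sum g ≡ ∑[ x < p ] g (x ↑ˡ q) + ∑[ y < q ] g (p ↑ʳ y)
sum-↑ zero    g = refl
sum-↑ (suc p) g = trans (cong (g zero +_) (sum-↑ p (g ∘ suc))) (sym (+-assoc (g zero) _ _))

∣-sum : ∀ {n d} (f : Fin n → ℕ) → (∀ i → d ∣ f i) → d ∣ sum f
∣-sum {zero}  f _   = _ ∣0
∣-sum {suc n} f d∣f = ∣m∣n⇒∣m+n (d∣f zero) (∣-sum (f ∘ suc) (d∣f ∘ suc))

-- Indicators of equality on Fin are written with does, not ⌊_⌋: does (suc a ≟ suc l)
-- reduces to does (a ≟ l), whereas ⌊ suc a ≟ suc l ⌋ is stuck on a different term.
sum-δ : ∀ {m} (a : Fin m) (h : Fin m → ℕ) → ∑[ l < m ] (b2n (does (a ≟ l)) * h l) ≡ h a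
sum-δ {suc m} zero    h =
  trans (cong₂ _+_ (+-identityʳ (h zero)) (sum-replicate-zero m)) (+-identityʳ (h zero))
sum-δ {suc m} (suc a) h = sum-δ a (h ∘ suc)

b2n-∧ : ∀ a b → b2n (a ∧ b) ≡ b2n a * b2n b
b2n-∧ true  b = sym (+-identityʳ (b2n b))
b2n-∧ false b = refl

b2n≤1 : ∀ b → b2n b ≤ 1
b2n≤1 true  = s≤s z≤n
b2n≤1 false = z≤n

T⇒b2n≡1 : ∀ {b} → T b → b2n b ≡ 1
T⇒b2n≡1 {true} _ = refl

¬T⇒b2n≡0 : ∀ {b} → ¬ T b → b2n b ≡ 0
¬T⇒b2n≡0 {true}  ¬t = contradiction tt ¬t
¬T⇒b2n≡0 {false} _  = refl

T-does : ∀ {a} {A : Set a} (a? : Dec A) → A → T (does a?)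
T-does (yes _)  _ = tt
T-does (no ¬a) a = ¬a a

b2n[0<ᵇ]≡ : ∀ {c} → c ≤ 1 → b2n (0 <ᵇ c) ≡ c
b2n[0<ᵇ]≡ z≤n       = refl
b2n[0<ᵇ]≡ (s≤s z≤n) = refl

b2n-≡ᵇ-subst : ∀ a b (h : ℕ → ℕ) → b2n (a ≡ᵇ b) * h a ≡ b2n (a ≡ᵇ b) * h b
b2n-≡ᵇ-subst a b h with a ≡ᵇ b in eq
... | true  = cong (λ c → 1 * h c) (≡ᵇ⇒≡ a b (Equivalence.from T-≡ eq))
... | false = refl

∣-*-b2n : ∀ {d r} b → (T b → d ∣ r) → d ∣ r * b2n b
∣-*-b2n {d} {r} true  d∣r = subst (d ∣_) (sym (*-identityʳ r)) (d∣r tt)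
∣-*-b2n {d} {r} false _   = subst (d ∣_) (sym (*-zeroʳ r)) (d ∣0)

count : ∀ {n} → (Fin n → Bool) → ℕ
count {n} P = ∑[ x < n ] b2n (P x)

count≤n : ∀ {n} (P : Fin n → Bool) → count P ≤ n
count≤n {zero}  P = z≤n
count≤n {suc n} P = +-mono-≤ (b2n≤1 (P zero)) (count≤n (P ∘ suc))

T⇒1≤count : ∀ {n} (P : Fin n → Bool) x → T (P x) → 1 ≤ count P
T⇒1≤count P zero    px = ≤-trans (≤-reflexive (sym (T⇒b2n≡1 px))) (m≤m+n _ _)
T⇒1≤count P (suc x) px = ≤-trans (T⇒1≤count (P ∘ suc) x px) (m≤n+m _ _)

count≡0 : ∀ {n} (P : Fin n → Bool) → (∀ x → ¬ T (P x)) → count P ≡ 0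
count≡0 {n} P none = trans (sum-cong-≗ (¬T⇒b2n≡0 ∘ none)) (sum-replicate-zero n)

AtMostOne : ∀ {n} → (Fin n → Bool) → Set
AtMostOne P = ∀ x y → T (P x) → T (P y) → x ≡ y

count≤1⇒atMostOne : ∀ {n} (P : Fin n → Bool) → count P ≤ 1 → AtMostOne P
count≤1⇒atMostOne P c≤1 zero    zero    _  _  = refl
count≤1⇒atMostOne P c≤1 zero    (suc y) px py =
  contradiction (≤-trans (+-mono-≤ (≤-reflexive (sym (T⇒b2n≡1 px))) (T⇒1≤count (P ∘ suc) y py)) c≤1)
                λ { (s≤s ()) }
count≤1⇒atMostOne P c≤1 (suc x) zero    px py =
  contradiction (≤-trans (+-mono-≤ (≤-reflexive (sym (T⇒b2n≡1 py))) (T⇒1≤count (P ∘ suc) x px)) c≤1)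
                λ { (s≤s ()) }
count≤1⇒atMostOne P c≤1 (suc x) (suc y) px py =
  cong suc (count≤1⇒atMostOne (P ∘ suc) (≤-trans (m≤n+m _ (b2n (P zero))) c≤1) x y px py)

atMostOne⇒count≤1 : ∀ {n} (P : Fin n → Bool) → AtMostOne P → count P ≤ 1
atMostOne⇒count≤1 {zero}  P _ = z≤n
atMostOne⇒count≤1 {suc n} P atMostOne with P zero in P₀
... | true  = ≤-reflexive (cong suc (count≡0 (P ∘ suc) λ y py →
                0≢1+n (atMostOne zero (suc y) (Equivalence.from T-≡ P₀) py)))
... | false = atMostOne⇒count≤1 (P ∘ suc) λ x y px py →
                Fin.suc-injective (atMostOne (suc x) (suc y) px py)

count-≡ᵇ-suc-toℕ : ∀ {n s} → 1 ≤ s → s ≤ n → count (λ (i : Fin n) → s ≡ᵇ suc (toℕ i)) ≡ 1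
count-≡ᵇ-suc-toℕ {suc n} {suc zero}    _ _         = cong suc (sum-replicate-zero n)
count-≡ᵇ-suc-toℕ {suc n} {suc (suc s)} _ (s≤s s<n) = count-≡ᵇ-suc-toℕ (s≤s z≤n) s<n

JointlyInjective : ∀ {n} → (Fin n → ℕ) → (Fin n → ℕ) → Set
JointlyInjective s t = ∀ x y → s x ≡ s y → t x ≡ t y → x ≡ y

KnowltonGraham⇔jointlyInjective : ∀ {n} (A B : Partition n) →
  KnowltonGraham A B ⇔ JointlyInjective (blockSize A) (blockSize B)
KnowltonGraham⇔jointlyInjective A B = mk⇔
  (λ kg x y a≡ b≡ → kg _ _ x y refl refl (sym a≡) (sym b≡))
  (λ inj j k x y ax bx ay by → inj x y (trans ax (sym ay)) (trans bx (sym by)))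

fibreSize : ∀ {n m} → (Fin n → Fin m) → Fin m → ℕ
fibreSize lab l = count (λ x → does (lab x ≟ l))

blockSize≡fibreSize : ∀ {n} (lab : Partition n) x → blockSize lab x ≡ fibreSize lab (lab x)
blockSize≡fibreSize lab x = trans (sumFin≡sum (λ y → if ⌊ lab y ≟ lab x ⌋ then 1 else 0))
  (sum-cong-≗ λ y → if-isYes (lab y ≟ lab x))
  where
  if-isYes : ∀ {a} {A : Set a} (a? : Dec A) → (if ⌊ a? ⌋ then 1 else 0) ≡ b2n (does a?)
  if-isYes (yes _) = refl
  if-isYes (no _)  = refl

blockSize-range : ∀ {n} (lab : Partition n) x → 1 ≤ blockSize lab x × blockSize lab x ≤ n
blockSize-range lab x rewrite blockSize≡fibreSize lab x =
  T⇒1≤count (λ y → does (lab y ≟ lab x)) x (T-does (lab x ≟ lab x) refl) , count≤n _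

∑-fibres : ∀ {n m} (lab : Fin n → Fin m) (h : Fin m → ℕ) →
           ∑[ x < n ] h (lab x) ≡ ∑[ l < m ] (fibreSize lab l * h l)
∑-fibres {n} {m} lab h = begin
  ∑[ x < n ] h (lab x)
    ≡⟨ sum-cong-≗ (λ x → sum-δ (lab x) h) ⟨
  ∑[ x < n ] ∑[ l < m ] (b2n (does (lab x ≟ l)) * h l)
    ≡⟨ ∑-comm (λ x l → b2n (does (lab x ≟ l)) * h l) ⟩
  ∑[ l < m ] ∑[ x < n ] (b2n (does (lab x ≟ l)) * h l)
    ≡⟨ sum-cong-≗ (λ l → *-distribʳ-sum (h l) (λ x → b2n (does (lab x ≟ l)))) ⟨
  ∑[ l < m ] (fibreSize lab l * h l) ∎

∣-count-blockSize : ∀ {n} (lab : Partition n) j → j ∣ count (λ x → blockSize lab x ≡ᵇ j)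
∣-count-blockSize lab j = subst (j ∣_) (sym count≡)
  (∣-sum _ λ l → ∣-*-b2n (fibreSize lab l ≡ᵇ j) (∣-reflexive ∘ sym ∘ ≡ᵇ⇒≡ (fibreSize lab l) j))
  where
  count≡ : count (λ x → blockSize lab x ≡ᵇ j) ≡
           ∑[ l < _ ] (fibreSize lab l * b2n (fibreSize lab l ≡ᵇ j))
  count≡ = trans (sum-cong-≗ λ x → cong (λ s → b2n (s ≡ᵇ j)) (blockSize≡fibreSize lab x))
                 (∑-fibres lab (λ l → b2n (fibreSize lab l ≡ᵇ j)))

module _ {a} {A : Set a} (_≟ᴬ_ : DecidableEquality A) where

  firstWithLabel : ∀ {n} → (Fin n → A) → Fin n → Fin n
  firstWithLabel ℓ zero    = zero
  firstWithLabel ℓ (suc x) with ℓ zero ≟ᴬ ℓ (suc x)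
  ... | yes _ = zero
  ... | no  _ = suc (firstWithLabel (ℓ ∘ suc) x)

  label-firstWithLabel : ∀ {n} (ℓ : Fin n → A) x → ℓ (firstWithLabel ℓ x) ≡ ℓ x
  label-firstWithLabel ℓ zero    = refl
  label-firstWithLabel ℓ (suc x) with ℓ zero ≟ᴬ ℓ (suc x)
  ... | yes ℓ₀≡ = ℓ₀≡
  ... | no  _   = label-firstWithLabel (ℓ ∘ suc) x

  firstWithLabel-cong : ∀ {n} (ℓ : Fin n → A) {x y} →
    ℓ x ≡ ℓ y → firstWithLabel ℓ x ≡ firstWithLabel ℓ y
  firstWithLabel-cong ℓ {zero}  {zero}  _ = refl
  firstWithLabel-cong ℓ {zero}  {suc y} ℓ≡ with ℓ zero ≟ᴬ ℓ (suc y)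
  ... | yes _  = refl
  ... | no  ℓ≢ = contradiction ℓ≡ ℓ≢
  firstWithLabel-cong ℓ {suc x} {zero}  ℓ≡ with ℓ zero ≟ᴬ ℓ (suc x)
  ... | yes _  = refl
  ... | no  ℓ≢ = contradiction (sym ℓ≡) ℓ≢
  firstWithLabel-cong ℓ {suc x} {suc y} ℓ≡ with ℓ zero ≟ᴬ ℓ (suc x) | ℓ zero ≟ᴬ ℓ (suc y)
  ... | yes _  | yes _  = refl
  ... | yes ℓx | no  ℓ≢ = contradiction (trans ℓx ℓ≡) ℓ≢
  ... | no  ℓ≢ | yes ℓy = contradiction (trans ℓy (sym ℓ≡)) ℓ≢
  ... | no  _  | no  _  = cong suc (firstWithLabel-cong (ℓ ∘ suc) ℓ≡)

  firstWithLabel-≡⇔ : ∀ {n} (ℓ : Fin n → A) {x y} →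
    firstWithLabel ℓ x ≡ firstWithLabel ℓ y ⇔ ℓ x ≡ ℓ y
  firstWithLabel-≡⇔ ℓ {x} {y} = mk⇔
    (λ eq → trans (sym (label-firstWithLabel ℓ x)) (trans (cong ℓ eq) (label-firstWithLabel ℓ y)))
    (firstWithLabel-cong ℓ)

  blockSize-firstWithLabel : ∀ {n} (ℓ : Fin n → A) x →
    blockSize (firstWithLabel ℓ) x ≡ count (λ y → does (ℓ y ≟ᴬ ℓ x))
  blockSize-firstWithLabel ℓ x = trans (blockSize≡fibreSize (firstWithLabel ℓ) x)
    (sum-cong-≗ λ y → cong b2n
      (does-⇔ (firstWithLabel-≡⇔ ℓ) (firstWithLabel ℓ y ≟ firstWithLabel ℓ x) (ℓ y ≟ᴬ ℓ x)))

rank : ∀ {n} → (Fin n → ℕ) → Fin n → ℕ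
rank f zero    = 0
rank f (suc x) = b2n (f zero ≡ᵇ f (suc x)) + rank (f ∘ suc) x

rank<count : ∀ {n} (f : Fin n → ℕ) x → rank f x < count (λ y → f y ≡ᵇ f x)
rank<count f zero    = T⇒1≤count (λ y → f y ≡ᵇ f zero) zero (≡⇒≡ᵇ (f zero) (f zero) refl)
rank<count f (suc x) = +-monoʳ-< (b2n (f zero ≡ᵇ f (suc x))) (rank<count (f ∘ suc) x)

∑-rank : ∀ {n} (f : Fin n → ℕ) v (g : ℕ → ℕ) →
         ∑[ x < n ] (b2n (f x ≡ᵇ v) * g (rank f x)) ≡ ∑[ r < count (λ x → f x ≡ᵇ v) ] g (toℕ r)
∑-rank {zero}  f v g = refl
∑-rank {suc n} f v g = begin
  b2n c * g 0 + ∑[ x < n ] (b2n (f (suc x) ≡ᵇ v) * g (b2n (f zero ≡ᵇ f (suc x)) + rank (f ∘ suc) x))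
    ≡⟨ cong (b2n c * g 0 +_) (sum-cong-≗ λ x →
         b2n-≡ᵇ-subst (f (suc x)) v λ u → g (b2n (f zero ≡ᵇ u) + rank (f ∘ suc) x)) ⟩
  b2n c * g 0 + ∑[ x < n ] (b2n (f (suc x) ≡ᵇ v) * g (b2n c + rank (f ∘ suc) x))
    ≡⟨ cong (b2n c * g 0 +_) (∑-rank (f ∘ suc) v (λ r → g (b2n c + r))) ⟩
  b2n c * g 0 + ∑[ r < count (λ x → f (suc x) ≡ᵇ v) ] g (b2n c + toℕ r)
    ≡⟨ prepend c ⟩
  ∑[ r < b2n c + count (λ x → f (suc x) ≡ᵇ v) ] g (toℕ r) ∎
  where
  c = f zero ≡ᵇ v
  prepend : ∀ b {m} → b2n b * g 0 + ∑[ r < m ] g (b2n b + toℕ r) ≡ ∑[ r < b2n b + m ] g (toℕ r)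
  prepend true  {m} = cong (_+ ∑[ r < m ] g (suc (toℕ r))) (+-identityʳ (g 0))
  prepend false = refl

∑-quotient-split : ∀ d .{{_ : NonZero d}} k (g : ℕ → ℕ) →
  ∑[ r < d + k ] g (toℕ r / d) ≡ d * g 0 + ∑[ r < k ] g (suc (toℕ r / d))
∑-quotient-split d k g = begin
  ∑[ r < d + k ] g (toℕ r / d)
    ≡⟨ sum-↑ d (λ r → g (toℕ r / d)) ⟩
  ∑[ r < d ] g (toℕ (r ↑ˡ k) / d) + ∑[ r < k ] g (toℕ (d ↑ʳ r) / d)
    ≡⟨ cong₂ _+_ (trans (sum-cong-≗ {d} (cong g ∘ head≡0)) (sum-const d (g 0)))
                 (sum-cong-≗ {k} (cong g ∘ tail≡)) ⟩
  d * g 0 + ∑[ r < k ] g (suc (toℕ r / d)) ∎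
  where
  head≡0 : ∀ r → toℕ (r ↑ˡ k) / d ≡ 0
  head≡0 r = trans (cong (_/ d) (toℕ-↑ˡ r k)) (m<n⇒m/n≡0 (toℕ<n r))
  tail≡ : ∀ r → toℕ (d ↑ʳ r) / d ≡ suc (toℕ r / d)
  tail≡ r = begin
    toℕ (d ↑ʳ r) / d          ≡⟨ cong (_/ d) (toℕ-↑ʳ d r) ⟩
    (d + toℕ r) / d           ≡⟨ m/n≡1+[m∸n]/n (m≤m+n d (toℕ r)) ⟩
    suc ((d + toℕ r ∸ d) / d) ≡⟨ cong (λ m → suc (m / d)) (m+n∸m≡n d (toℕ r)) ⟩
    suc (toℕ r / d)           ∎

count-quotient≡ : ∀ d .{{_ : NonZero d}} k q → q < k →
                  count (λ (r : Fin (k * d)) → toℕ r / d ≡ᵇ q) ≡ d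
count-quotient≡ d (suc k) zero    _         = begin
  ∑[ r < d + k * d ] b2n (toℕ r / d ≡ᵇ 0) ≡⟨ ∑-quotient-split d (k * d) (λ m → b2n (m ≡ᵇ 0)) ⟩
  d * 1 + ∑[ r < k * d ] 0                ≡⟨ cong₂ _+_ (*-identityʳ d) (sum-replicate-zero (k * d)) ⟩
  d + 0                                   ≡⟨ +-identityʳ d ⟩
  d                                       ∎
count-quotient≡ d (suc k) (suc q) (s≤s q<k) = begin
  ∑[ r < d + k * d ] b2n (toℕ r / d ≡ᵇ suc q)
    ≡⟨ ∑-quotient-split d (k * d) (λ m → b2n (m ≡ᵇ suc q)) ⟩
  d * 0 + count (λ (r : Fin (k * d)) → toℕ r / d ≡ᵇ q)
    ≡⟨ cong (_+ count (λ (r : Fin (k * d)) → toℕ r / d ≡ᵇ q)) (*-zeroʳ d) ⟩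
  count (λ (r : Fin (k * d)) → toℕ r / d ≡ᵇ q)
    ≡⟨ count-quotient≡ d k q q<k ⟩
  d ∎

_≟ℕ²_ : DecidableEquality (ℕ × ℕ)
_≟ℕ²_ = ≡-dec _≟ℕ_ _≟ℕ_

does-≟ℕ² : ∀ a b c d → does ((a , b) ≟ℕ² (c , d)) ≡ (a ≡ᵇ c) ∧ (b ≡ᵇ d)
does-≟ℕ² a b c d = does-⇔ (mk⇔ ×-≡,≡←≡ ×-≡,≡→≡) ((a , b) ≟ℕ² (c , d)) (a ≟ℕ c ×-dec b ≟ℕ d)

chunkLabel : ∀ {n} → (Fin n → ℕ) → Fin n → ℕ × ℕ
chunkLabel f x = f x , rank f x / suc (f x)

count-chunkLabel : ∀ {n} (f : Fin n → ℕ) → (∀ v → suc v ∣ count (λ x → f x ≡ᵇ v)) →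
  ∀ x → count (λ y → does (chunkLabel f y ≟ℕ² chunkLabel f x)) ≡ suc (f x)
count-chunkLabel f f∣ x with f∣ (f x)
... | divides k count≡k*d = begin
  count (λ y → does (chunkLabel f y ≟ℕ² chunkLabel f x))
    ≡⟨ sum-cong-≗ (λ y → trans (cong b2n (does-≟ℕ² (f y) _ (f x) q)) (b2n-∧ (f y ≡ᵇ f x) _)) ⟩
  ∑[ y < _ ] (b2n (f y ≡ᵇ f x) * b2n (rank f y / suc (f y) ≡ᵇ q))
    ≡⟨ sum-cong-≗ (λ y → b2n-≡ᵇ-subst (f y) (f x) λ v → b2n (rank f y / suc v ≡ᵇ q)) ⟩
  ∑[ y < _ ] (b2n (f y ≡ᵇ f x) * b2n (rank f y / d ≡ᵇ q))
    ≡⟨ ∑-rank f (f x) (λ r → b2n (r / d ≡ᵇ q)) ⟩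
  ∑[ r < count (λ y → f y ≡ᵇ f x) ] b2n (toℕ r / d ≡ᵇ q)
    ≡⟨ cong (λ c → ∑[ r < c ] b2n (toℕ r / d ≡ᵇ q)) count≡k*d ⟩
  ∑[ r < k * d ] b2n (toℕ r / d ≡ᵇ q)
    ≡⟨ count-quotient≡ d k q (m<n*o⇒m/o<n (subst (rank f x <_) count≡k*d (rank<count f x))) ⟩
  d ∎
  where
  d = suc (f x)
  q = rank f x / d

blockSizes-realisable : ∀ {n} (f : Fin n → ℕ) → (∀ v → suc v ∣ count (λ x → f x ≡ᵇ v)) →
  Σ (Partition n) λ P → ∀ x → blockSize P x ≡ suc (f x)
blockSizes-realisable f f∣ = firstWithLabel _≟ℕ²_ (chunkLabel f) , λ x →
  trans (blockSize-firstWithLabel _≟ℕ²_ (chunkLabel f) x) (count-chunkLabel f f∣ x)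

sizeMatrix : ∀ {n} → (Fin n → ℕ) → (Fin n → ℕ) → Matrix01 n
sizeMatrix s t i k = 0 <ᵇ count (λ x → (s x ≡ᵇ suc (toℕ i)) ∧ (t x ≡ᵇ suc (toℕ k)))

rowSum-sizeMatrix : ∀ {n} (s t : Fin n → ℕ) → JointlyInjective s t → (∀ x → 1 ≤ t x × t x ≤ n) →
  ∀ i → rowSum (sizeMatrix s t) i ≡ count (λ x → s x ≡ᵇ suc (toℕ i))
rowSum-sizeMatrix {n} s t inj t-range i = begin
  rowSum (sizeMatrix s t) i
    ≡⟨ sumFin≡sum (b2n ∘ sizeMatrix s t i) ⟩
  ∑[ k < n ] b2n (sizeMatrix s t i k)
    ≡⟨ sum-cong-≗ {n} (λ k → b2n[0<ᵇ]≡ (atMostOne⇒count≤1 (P k) (P-atMostOne k))) ⟩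
  ∑[ k < n ] count (P k)
    ≡⟨ sum-cong-≗ {n} (λ k → sum-cong-≗ {n} λ x → b2n-∧ (s≡ x) (t≡ k x)) ⟩
  ∑[ k < n ] ∑[ x < n ] (b2n (s≡ x) * b2n (t≡ k x))
    ≡⟨ ∑-comm {n} {n} (λ k x → b2n (s≡ x) * b2n (t≡ k x)) ⟩
  ∑[ x < n ] ∑[ k < n ] (b2n (s≡ x) * b2n (t≡ k x))
    ≡⟨ sum-cong-≗ {n} (λ x → *-distribˡ-sum {n} (b2n (s≡ x)) (λ k → b2n (t≡ k x))) ⟨
  ∑[ x < n ] (b2n (s≡ x) * count {n} (λ k → t≡ k x))
    ≡⟨ sum-cong-≗ {n} (λ x → cong (b2n (s≡ x) *_) (uncurry (count-≡ᵇ-suc-toℕ {n}) (t-range x))) ⟩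
  ∑[ x < n ] (b2n (s≡ x) * 1)
    ≡⟨ sum-cong-≗ {n} (λ x → *-identityʳ (b2n (s≡ x))) ⟩
  count s≡ ∎
  where
  s≡ : Fin n → Bool
  s≡ x = s x ≡ᵇ suc (toℕ i)
  t≡ : Fin n → Fin n → Bool
  t≡ k x = t x ≡ᵇ suc (toℕ k)
  P : Fin n → Fin n → Bool
  P k x = s≡ x ∧ t≡ k x
  P-atMostOne : ∀ k → AtMostOne (P k)
  P-atMostOne k x y Px Py with Equivalence.to T-∧ Px | Equivalence.to T-∧ Py
  ... | sx , tx | sy , ty = inj x y (trans (≡ᵇ⇒≡ _ _ sx) (sym (≡ᵇ⇒≡ _ _ sy)))
                                    (trans (≡ᵇ⇒≡ _ _ tx) (sym (≡ᵇ⇒≡ _ _ ty)))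

colSum-sizeMatrix : ∀ {n} (s t : Fin n → ℕ) k → colSum (sizeMatrix s t) k ≡ rowSum (sizeMatrix t s) k
colSum-sizeMatrix {n} s t k = begin
  colSum (sizeMatrix s t) k
    ≡⟨ sumFin≡sum (λ i → b2n (sizeMatrix s t i k)) ⟩
  ∑[ i < n ] b2n (sizeMatrix s t i k)
    ≡⟨ sum-cong-≗ {n} (λ i → cong (λ c → b2n (0 <ᵇ c)) (sum-cong-≗ {n} λ x →
         cong b2n (∧-comm (s x ≡ᵇ suc (toℕ i)) (t x ≡ᵇ suc (toℕ k))))) ⟩
  ∑[ i < n ] b2n (sizeMatrix t s k i)
    ≡⟨ sumFin≡sum (b2n ∘ sizeMatrix t s k) ⟨
  rowSum (sizeMatrix t s) k ∎

∑-count-sizes : ∀ {n} (s : Fin n → ℕ) → (∀ x → 1 ≤ s x × s x ≤ n) →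
  ∑[ i < n ] count (λ x → s x ≡ᵇ suc (toℕ i)) ≡ n
∑-count-sizes {n} s s-range = begin
  ∑[ i < n ] count (λ x → s x ≡ᵇ suc (toℕ i))
    ≡⟨ ∑-comm {n} {n} (λ i x → b2n (s x ≡ᵇ suc (toℕ i))) ⟩
  ∑[ x < n ] count {n} (λ i → s x ≡ᵇ suc (toℕ i))
    ≡⟨ sum-cong-≗ {n} (uncurry (count-≡ᵇ-suc-toℕ {n}) ∘ s-range) ⟩
  ∑[ x < n ] 1
    ≡⟨ sum-const n 1 ⟩
  n * 1
    ≡⟨ *-identityʳ n ⟩
  n ∎

sizeMatrix-good : ∀ {n} (A B : Partition n) → KnowltonGraham A B →
  GoodMatrix n n (sizeMatrix (blockSize A) (blockSize B))
sizeMatrix-good {n} A B kg =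
  (λ i → subst (suc (toℕ i) ∣_) (sym (rowSum≡ i)) (∣-count-blockSize A _)) ,
  (λ k → subst (suc (toℕ k) ∣_) (sym (colSum≡ k)) (∣-count-blockSize B _)) ,
  total rowSum≡ (blockSize-range A) ,
  total colSum≡ (blockSize-range B)
  where
  M = sizeMatrix (blockSize A) (blockSize B)
  inj : JointlyInjective (blockSize A) (blockSize B)
  inj = Equivalence.to (KnowltonGraham⇔jointlyInjective A B) kg
  rowSum≡ : ∀ i → rowSum M i ≡ count (λ x → blockSize A x ≡ᵇ suc (toℕ i))
  rowSum≡ = rowSum-sizeMatrix (blockSize A) (blockSize B) inj (blockSize-range B)
  colSum≡ : ∀ k → colSum M k ≡ count (λ x → blockSize B x ≡ᵇ suc (toℕ k))
  colSum≡ k = trans (colSum-sizeMatrix (blockSize A) (blockSize B) k)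
                    (rowSum-sizeMatrix (blockSize B) (blockSize A) (λ x y tx sx → inj x y sx tx)
                                       (blockSize-range A) k)
  total : ∀ {s} {lineSum : Fin n → ℕ} → (∀ i → lineSum i ≡ count (λ x → s x ≡ᵇ suc (toℕ i))) →
          (∀ x → 1 ≤ s x × s x ≤ n) → sumFin lineSum ≡ n
  total {s} {lineSum} lineSum≡ s-range =
    trans (sumFin≡sum lineSum) (trans (sum-cong-≗ lineSum≡) (∑-count-sizes s s-range))

concatenate : ∀ {a} {A : Set} (w : Fin a → ℕ) → ((i : Fin a) → Fin (w i) → A) → Fin (∑[ i < a ] w i) → A
concatenate {zero}  w h ()
concatenate {suc a} w h = h zero ++ concatenate (w ∘ suc) (h ∘ suc)

∑-concatenate : ∀ {a} {A : Set} (w : Fin a → ℕ) (h : (i : Fin a) → Fin (w i) → A) (g : A → ℕ) →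
  ∑[ x < ∑[ i < a ] w i ] g (concatenate w h x) ≡ ∑[ i < a ] ∑[ j < w i ] g (h i j)
∑-concatenate {zero}  w h g = refl
∑-concatenate {suc a} w h g = begin
  sum (g ∘ (h zero ++ rest))
    ≡⟨ sum-↑ (w zero) (g ∘ (h zero ++ rest)) ⟩
  ∑[ j < w zero ] g ((h zero ++ rest) (j ↑ˡ _)) + ∑[ x < _ ] g ((h zero ++ rest) (w zero ↑ʳ x))
    ≡⟨ cong₂ _+_ (sum-cong-≗ {w zero} (cong g ∘ lookup-++ˡ (h zero) rest))
                 (sum-cong-≗ {∑[ i < a ] w (suc i)} (cong g ∘ lookup-++ʳ (h zero) rest)) ⟩
  ∑[ j < w zero ] g (h zero j) + sum (g ∘ rest)
    ≡⟨ cong (∑[ j < w zero ] g (h zero j) +_) (∑-concatenate (w ∘ suc) (h ∘ suc) g) ⟩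
  ∑[ j < w zero ] g (h zero j) + ∑[ i < a ] ∑[ j < w (suc i) ] g (h (suc i) j) ∎
  where
  rest = concatenate (w ∘ suc) (h ∘ suc)

ones : ∀ {m} → Matrix01 m → ℕ
ones {m} M = ∑[ i < m ] ∑[ k < m ] b2n (M i k)

support : ∀ {m} (M : Matrix01 m) → Fin (ones M) → Fin m × Fin m
support M = concatenate _ λ i → concatenate _ λ k _ → i , k

∑-support : ∀ {m} (M : Matrix01 m) (g : Fin m × Fin m → ℕ) →
  sum (g ∘ support M) ≡ ∑[ i < m ] ∑[ k < m ] (b2n (M i k) * g (i , k))
∑-support {m} M g =
  trans (∑-concatenate _ (λ i → concatenate _ λ k _ → i , k) g) (sum-cong-≗ {m} λ i →
  trans (∑-concatenate (b2n ∘ M i) (λ k _ → i , k) g) (sum-cong-≗ {m} λ k →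
  sum-const (b2n (M i k)) (g (i , k))))

support-injective : ∀ {m} (M : Matrix01 m) {x y} → support M x ≡ support M y → x ≡ y
support-injective {m} M {x} {y} eq = count≤1⇒atMostOne at-i₀k₀ count≤1 x y (hits eq) (hits refl)
  where
  i₀ = proj₁ (support M y)
  k₀ = proj₂ (support M y)
  at-i₀k₀ : Fin (ones M) → Bool
  at-i₀k₀ z = does (i₀ ≟ proj₁ (support M z)) ∧ does (k₀ ≟ proj₂ (support M z))
  hits : ∀ {z} → support M z ≡ support M y → T (at-i₀k₀ z)
  hits {z} eq = Equivalence.from T-∧ (T-does (i₀ ≟ proj₁ (support M z)) (sym (cong proj₁ eq)) ,
                                      T-does (k₀ ≟ proj₂ (support M z)) (sym (cong proj₂ eq)))
  δ₁ δ₂ : Fin m → ℕ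
  δ₁ i = b2n (does (i₀ ≟ i))
  δ₂ k = b2n (does (k₀ ≟ k))
  rearrange : ∀ a b c → a * b2n (b ∧ c) ≡ b2n b * (b2n c * a)
  rearrange a b c = trans (cong (a *_) (b2n-∧ b c)) (trans (*-comm a _) (*-assoc (b2n b) (b2n c) a))
  count≡ : count at-i₀k₀ ≡ b2n (M i₀ k₀)
  count≡ = begin
    count at-i₀k₀
      ≡⟨ ∑-support M (λ (i , k) → b2n (does (i₀ ≟ i) ∧ does (k₀ ≟ k))) ⟩
    ∑[ i < m ] ∑[ k < m ] (b2n (M i k) * b2n (does (i₀ ≟ i) ∧ does (k₀ ≟ k)))
      ≡⟨ sum-cong-≗ {m} (λ i → sum-cong-≗ {m} λ k →
           rearrange (b2n (M i k)) (does (i₀ ≟ i)) (does (k₀ ≟ k))) ⟩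
    ∑[ i < m ] ∑[ k < m ] (δ₁ i * (δ₂ k * b2n (M i k)))
      ≡⟨ sum-cong-≗ {m} (λ i → *-distribˡ-sum (δ₁ i) (λ k → δ₂ k * b2n (M i k))) ⟨
    ∑[ i < m ] (δ₁ i * ∑[ k < m ] (δ₂ k * b2n (M i k)))
      ≡⟨ sum-cong-≗ {m} (λ i → cong (δ₁ i *_) (sum-δ k₀ (b2n ∘ M i))) ⟩
    ∑[ i < m ] (δ₁ i * b2n (M i k₀))
      ≡⟨ sum-δ i₀ (λ i → b2n (M i k₀)) ⟩
    b2n (M i₀ k₀) ∎
  count≤1 : count at-i₀k₀ ≤ 1
  count≤1 = subst (_≤ 1) (sym count≡) (b2n≤1 (M i₀ k₀))

∣-∑-rows : ∀ {m} (M : Matrix01 m) → (∀ i → suc (toℕ i) ∣ rowSum M i) → ∀ v →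
  suc v ∣ ∑[ i < m ] ∑[ k < m ] (b2n (M i k) * b2n (toℕ i ≡ᵇ v))
∣-∑-rows {m} M rows∣ v =
  subst (suc v ∣_) (sum-cong-≗ {m} λ i → *-distribʳ-sum (b2n (toℕ i ≡ᵇ v)) (b2n ∘ M i))
    (∣-sum _ λ i → ∣-*-b2n (toℕ i ≡ᵇ v) λ i≡v →
      subst (λ u → suc u ∣ sum (b2n ∘ M i)) (≡ᵇ⇒≡ _ _ i≡v)
            (subst (_ ∣_) (sumFin≡sum (b2n ∘ M i)) (rows∣ i)))

goodMatrix⇒KGExists : ∀ {m n} (M : Matrix01 m) →
  (∀ i → suc (toℕ i) ∣ rowSum M i) → (∀ k → suc (toℕ k) ∣ colSum M k) → sumFin (rowSum M) ≡ n →
  KGExists n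
goodMatrix⇒KGExists {m} M rows∣ cols∣ total = subst KGExists (trans (sym total≡) total) (A , B , kg)
  where
  total≡ : sumFin (rowSum M) ≡ ones M
  total≡ = trans (sumFin≡sum (rowSum M)) (sum-cong-≗ {m} λ i → sumFin≡sum (b2n ∘ M i))
  row col : Fin (ones M) → ℕ
  row x = toℕ (proj₁ (support M x))
  col x = toℕ (proj₂ (support M x))
  row∣ : ∀ v → suc v ∣ count (λ x → row x ≡ᵇ v)
  row∣ v = subst (suc v ∣_) (sym (∑-support M λ (i , _) → b2n (toℕ i ≡ᵇ v))) (∣-∑-rows M rows∣ v)
  col∣ : ∀ v → suc v ∣ count (λ x → col x ≡ᵇ v)
  col∣ v = subst (suc v ∣_)
    (sym (trans (∑-support M λ (_ , k) → b2n (toℕ k ≡ᵇ v))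
                (∑-comm {m} {m} λ i k → b2n (M i k) * b2n (toℕ k ≡ᵇ v))))
    (∣-∑-rows (flip M) cols∣ v)
  A-sized = blockSizes-realisable row row∣
  B-sized = blockSizes-realisable col col∣
  A B : Partition (ones M)
  A = proj₁ A-sized
  B = proj₁ B-sized
  coordinate-≡ : ∀ {P} {c : _ → Fin m} → (∀ x → blockSize P x ≡ suc (toℕ (c x))) →
                 ∀ {x y} → blockSize P x ≡ blockSize P y → c x ≡ c y
  coordinate-≡ size≡ {x} {y} eq =
    toℕ-injective (suc-injective (trans (sym (size≡ x)) (trans eq (size≡ y))))
  kg : KnowltonGraham A B
  kg = Equivalence.from (KnowltonGraham⇔jointlyInjective A B) λ x y A≡ B≡ →
    support-injective M (×-≡,≡→≡ (coordinate-≡ (proj₂ A-sized) A≡ , coordinate-≡ (proj₂ B-sized) B≡))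

lemma1 : (n : ℕ) → 1 ≤ n →
    KGExists n ⇔ Σ ℕ (λ m → 1 ≤ m × Σ (Matrix01 m) (λ M → GoodMatrix m n M))
lemma1 n 1≤n = mk⇔
  (λ (A , B , kg) → n , 1≤n , sizeMatrix (blockSize A) (blockSize B) , sizeMatrix-good A B kg)
  (λ (m , _ , M , rows∣ , cols∣ , total , _) → goodMatrix⇒KGExists M rows∣ cols∣ total)
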